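{- Let $X$ be a finite set and $\mathcal{A}$ a collection of distinct subsets of $X$ with $|\mathcal{A}|=|X|$. Then $(\mathcal{A},X)$ is extremal if and only if (i) $\bigcup_{A\in\mathcal{A}}A=X$, and (ii) for every $A\in\mathcal{A}$ with at least two elements, there is $x\in A$ such that $A-\{x\}\in\mathcal{A}$.
   Context: A set system $(\mathcal{A},X)$ is extremal if the members of $\mathcal{A}$ are distinct and nonempty, and for every $x\in X$ either there is $A\in\mathcal{A}$ with $A-\{x\}=\emptyset$ or there are distinct $A,A'\in\mathcal{A}$ with $A-\{x\}=A'-\{x\}$. -}

module Defs where

open import Data.Nat using (ℕ; _≤_)
open import Data.Fin using (Fin)
open import Data.Fin.Subset using (Subset; _∈_; _-_; ⊥; Nonempty; ∣_∣)
open import Data.Product using (_×_; ∃; ∃-syntax)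
open import Data.Sum using (_⊎_)
open import Relation.Binary.PropositionalEquality using (_≡_; _≢_)
open import Function.Definitions using (Injective)

-- A set system (𝒜, X) with X = Fin n and 𝒜 given as an indexed family
-- F : Fin m → Subset n (members F i; distinctness of members = injectivity of F).

Distinct : ∀ {m n} → (Fin m → Subset n) → Set
Distinct F = Injective _≡_ _≡_ F

Extremal : ∀ {m n} → (Fin m → Subset n) → Set
Extremal {m} {n} F =
  Distinct F ×
  (∀ (i : Fin m) → Nonempty (F i)) ×
  (∀ (x : Fin n) →
     (∃[ i ] (F i - x ≡ ⊥)) ⊎
     (∃[ i ] ∃[ j ] (i ≢ j × F i - x ≡ F j - x)))

CoversX : ∀ {m n} → (Fin m → Subset n) → Set
CoversX {m} {n} F = ∀ (x : Fin n) → ∃[ i ] (x ∈ F i)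

DownClosedStep : ∀ {m n} → (Fin m → Subset n) → Set
DownClosedStep {m} {n} F =
  ∀ (i : Fin m) → 2 ≤ ∣ F i ∣ →
    ∃[ x ] (x ∈ F i × ∃[ j ] (F j ≡ F i - x))

module Submission where

-- Call x ∈ X removable if some A ∈ 𝒜 contains x with A - {x} ∈ 𝒜 ∪ {∅}; for
-- distinct nonempty members this is exactly the extremality condition at x.
-- Sets differing in exactly one element x form an x-edge, and Bondy's argument
-- shows that k distinct sets carry edges of fewer than k distinct directions.
-- (⇐) Condition (ii) lets any x ∈ A ∈ 𝒜 descend until it is removable; if ∅
-- were in 𝒜, the n members would then carry edges of all n directions.
-- (⇒) The n removals are n edges on the n + 1 sets of 𝒜 ∪ {∅}; Bondy applied
-- to both sides of a split shows this graph is connected, so every member is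
-- reached from ∅ by adding one element at a time, and the last step into a
-- member with at least two elements witnesses (ii).

open import Defs
open import Data.Nat using (ℕ; zero; suc; _+_; _≤_; _<_; _≤?_; z≤n; s≤s)
open import Data.Nat.Properties
  using (≤-trans; ≤-reflexive; ≤-pred; <-irrefl; ≰⇒>; n≤0⇒n≡0; 0≢1+n; n<1+n; +-suc; +-mono-≤; module ≤-Reasoning)
open import Data.Fin using (Fin; zero; suc; _≟_)
open import Data.Fin.Properties using (any?)
open import Data.Fin.Subset using (Subset; inside; outside; _∈_; _∉_; _⊆_; _-_; ⊥; ⁅_⁆; Nonempty; ∣_∣)
open import Data.Fin.Subset.Properties
  using (_∈?_; x∈p∧x≢y⇒x∈p-y; p─q⊆p; p─⊥≡p; p─q─q≡p─q; p─x─y≡p─y─x; ⊆-antisym; ∣p∣≤n; ∣⊥∣≡0; ∉⊥; Empty-unique; nonempty?)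
open import Data.Vec using (_∷_; here; there)
open import Data.Vec.Properties using (≡-dec)
import Data.Bool as Bool
open import Data.List using (List; []; _∷_; _++_; length; map; filter; deduplicate; allFin)
open import Data.List.Properties using (length-map; length-tabulate)
open import Data.List.Relation.Unary.Any using (here; there)
import Data.List.Relation.Unary.All as All
open import Data.List.Relation.Unary.AllPairs using ([]; _∷_)
open import Data.List.Relation.Unary.Unique.Propositional using (Unique)
open import Data.List.Relation.Unary.Unique.Propositional.Properties using (allFin⁺; map⁺; filter⁺)
open import Data.List.Relation.Unary.Unique.DecPropositional.Properties using (deduplicate-!)
open import Data.List.Membership.Propositional using () renaming (_∈_ to _∈ₗ_)
open import Data.List.Membership.Propositional.Properties
  using (∈-∃++; ∈-map⁺; ∈-map⁻; ∈-filter⁺; ∈-filter⁻; ∈-deduplicate⁺; ∈-deduplicate⁻; ∈-allFin)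
open import Data.List.Relation.Binary.Subset.Propositional using () renaming (_⊆_ to _⊆ₗ_)
open import Data.List.Relation.Binary.Permutation.Propositional using (_↭_)
open import Data.List.Relation.Binary.Permutation.Propositional.Properties using (shift; ↭-length; ∈-resp-↭)
open import Data.Product using (_×_; _,_; proj₁; proj₂; ∃₂; ∃-syntax)
open import Data.Sum using (_⊎_; inj₁; inj₂)
open import Relation.Binary.PropositionalEquality using (_≡_; _≢_; refl; sym; trans; cong; subst; subst₂; module ≡-Reasoning)
open import Relation.Nullary using (Dec; yes; no; contradiction)
open import Relation.Nullary.Decidable using (_×-dec_)
open import Relation.Unary using (Pred; Decidable)
open import Relation.Unary.Properties using (∁?)
open import Function.Base using (_∘_)
open import Function.Bundles using (_⇔_; mk⇔; Equivalence)

module _ {a} {A : Set a} where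

  ∈⇒↭∷ : ∀ {x : A} {xs} → x ∈ₗ xs → ∃[ ys ] xs ↭ x ∷ ys
  ∈⇒↭∷ x∈xs with ys , zs , refl ← ∈-∃++ x∈xs = ys ++ zs , shift _ ys zs

  Unique∧⊆⇒length≤ : ∀ {xs ys : List A} → Unique xs → xs ⊆ₗ ys → length xs ≤ length ys
  Unique∧⊆⇒length≤ [] _ = z≤n
  Unique∧⊆⇒length≤ {x ∷ xs} (x≢xs ∷ uxs) x∷xs⊆ys
    with zs , ys↭x∷zs ← ∈⇒↭∷ (x∷xs⊆ys (here refl)) =
    subst (suc (length xs) ≤_) (sym (↭-length ys↭x∷zs)) (s≤s (Unique∧⊆⇒length≤ uxs xs⊆zs))
    where
    xs⊆zs : xs ⊆ₗ zs
    xs⊆zs y∈xs with ∈-resp-↭ ys↭x∷zs (x∷xs⊆ys (there y∈xs))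
    ... | here y≡x   = contradiction (sym y≡x) (All.lookup x≢xs y∈xs)
    ... | there y∈zs = y∈zs

  length-filter+length-filter-∁ : ∀ {p} {P : Pred A p} (P? : Decidable P) xs →
    length (filter P? xs) + length (filter (∁? P?) xs) ≡ length xs
  length-filter+length-filter-∁ P? [] = refl
  length-filter+length-filter-∁ P? (x ∷ xs) with P? x
  ... | yes _ = cong suc (length-filter+length-filter-∁ P? xs)
  ... | no _  = trans (+-suc _ _) (cong suc (length-filter+length-filter-∁ P? xs))

length-allFin : ∀ n → length (allFin n) ≡ n
length-allFin n = length-tabulate {n = n} (λ i → i)

private variable
  n : ℕ
  x y : Fin n
  p q : Subset n

_≟ˢ_ : (p q : Subset n) → Dec (p ≡ q)
_≟ˢ_ = ≡-dec Bool._≟_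

x∉p-x : (x : Fin n) (p : Subset n) → x ∉ p - x
x∉p-x zero    (_ ∷ p) ()
x∉p-x (suc x) (_ ∷ p) (there x∈p-x) = x∉p-x x p x∈p-x

x∉p⇒p-x≡p : x ∉ p → p - x ≡ p
x∉p⇒p-x≡p {x = x} {p} x∉p =
  ⊆-antisym (p─q⊆p p ⁅ x ⁆) (λ y∈p → x∈p∧x≢y⇒x∈p-y y∈p λ { refl → x∉p y∈p })

p-y≡q-y⇒x∈p⇒x∈q : x ≢ y → p - y ≡ q - y → x ∈ p → x ∈ q
p-y≡q-y⇒x∈p⇒x∈q {x = x} {y = y} {q = q} x≢y eq x∈p =
  p─q⊆p q ⁅ y ⁆ (subst (x ∈_) eq (x∈p∧x≢y⇒x∈p-y x∈p x≢y))

p-x≡q-x⇒p⊆q : (x ∈ p → x ∈ q) → p - x ≡ q - x → p ⊆ q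
p-x≡q-x⇒p⊆q {x = x} x∈p⇒x∈q eq {z} z∈p with z ≟ x
... | yes refl = x∈p⇒x∈q z∈p
... | no z≢x   = p-y≡q-y⇒x∈p⇒x∈q z≢x eq z∈p

p-x≡q-x⇒p≡q : (x ∈ p → x ∈ q) → (x ∈ q → x ∈ p) → p - x ≡ q - x → p ≡ q
p-x≡q-x⇒p≡q x∈p⇒x∈q x∈q⇒x∈p eq =
  ⊆-antisym (p-x≡q-x⇒p⊆q x∈p⇒x∈q eq) (p-x≡q-x⇒p⊆q x∈q⇒x∈p (sym eq))

p-y≡q-y⇒p-x-y≡q-x-y : p - y ≡ q - y → p - x - y ≡ q - x - y
p-y≡q-y⇒p-x-y≡q-x-y {p = p} {y = y} {q = q} {x = x} p-y≡q-y = begin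
  p - x - y  ≡⟨ p─x─y≡p─y─x p x y ⟩
  p - y - x  ≡⟨ cong (_- x) p-y≡q-y ⟩
  q - y - x  ≡⟨ p─x─y≡p─y─x q y x ⟩
  q - x - y  ∎
  where open ≡-Reasoning

x∈p⇒∣p∣≡1+∣p-x∣ : x ∈ p → ∣ p ∣ ≡ suc ∣ p - x ∣
x∈p⇒∣p∣≡1+∣p-x∣ {x = zero}  {_ ∷ p}       here        = cong (λ r → suc ∣ r ∣) (sym (p─⊥≡p p))
x∈p⇒∣p∣≡1+∣p-x∣ {x = suc x} {inside ∷ p}  (there x∈p) = cong suc (x∈p⇒∣p∣≡1+∣p-x∣ x∈p)
x∈p⇒∣p∣≡1+∣p-x∣ {x = suc x} {outside ∷ p} (there x∈p) = x∈p⇒∣p∣≡1+∣p-x∣ x∈p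

∣p∣≡0⇒p≡⊥ : ∣ p ∣ ≡ 0 → p ≡ ⊥
∣p∣≡0⇒p≡⊥ ∣p∣≡0 = Empty-unique λ (z , z∈p) → 0≢1+n (trans (sym ∣p∣≡0) (x∈p⇒∣p∣≡1+∣p-x∣ z∈p))

x∈p⇒∣p∣≤1⇒p-x≡⊥ : x ∈ p → ∣ p ∣ ≤ 1 → p - x ≡ ⊥
x∈p⇒∣p∣≤1⇒p-x≡⊥ x∈p ∣p∣≤1 =
  ∣p∣≡0⇒p≡⊥ (n≤0⇒n≡0 (≤-pred (subst (_≤ 1) (x∈p⇒∣p∣≡1+∣p-x∣ x∈p) ∣p∣≤1)))

Edge : List (Subset n) → Fin n → Set
Edge W x = ∃₂ λ C C' → C ∈ₗ W × C' ∈ₗ W × C ≢ C' × C - x ≡ C' - x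

removal-edge : ∀ {C W} → x ∈ C → C ∈ₗ W → C - x ∈ₗ W → Edge W x
removal-edge {x = x} {C} x∈C C∈W C-x∈W =
  C , C - x , C∈W , C-x∈W ,
  (λ C≡C-x → x∉p-x x C (subst (x ∈_) C≡C-x x∈C)) ,
  sym (p─q─q≡p─q C ⁅ x ⁆)

-- Deleting x from every member merges the two ends of an x-edge, while an
-- edge of any other direction y stays an edge with two distinct ends.
bondy : (D : List (Fin n)) → Unique D → ∀ {W C} → Unique W → C ∈ₗ W →
        (∀ {x} → x ∈ₗ D → Edge W x) → length D < length W
bondy [] _ {_ ∷ _} _ _ _ = s≤s z≤n
bondy (x ∷ D) (x≢D ∷ uD) {W} uW _ edges
  with C , C' , C∈W , C'∈W , C≢C' , C-x≡C'-x ← edges (here refl)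
  with zs , W↭C'∷zs ← ∈⇒↭∷ C'∈W = begin-strict
    suc (length D)   ≤⟨ bondy D uD (deduplicate-! _≟ˢ_ (map (_- x) W)) (contract C∈W) edges′ ⟩
    length W′        ≤⟨ ∣W′∣≤∣zs∣ ⟩
    length zs        <⟨ n<1+n _ ⟩
    suc (length zs)  ≡⟨ ↭-length W↭C'∷zs ⟨
    length W         ∎
  where
  open ≤-Reasoning

  W′ : List (Subset _)
  W′ = deduplicate _≟ˢ_ (map (_- x) W)

  contract : ∀ {E} → E ∈ₗ W → E - x ∈ₗ W′
  contract E∈W = ∈-deduplicate⁺ _≟ˢ_ (∈-map⁺ (_- x) E∈W)

  W′⊆ : W′ ⊆ₗ map (_- x) zs
  W′⊆ E∈W′ with y , y∈W , refl ← ∈-map⁻ (_- x) (∈-deduplicate⁻ _≟ˢ_ (map (_- x) W) E∈W′)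
    with ∈-resp-↭ W↭C'∷zs y∈W
  ... | there y∈zs = ∈-map⁺ (_- x) y∈zs
  ... | here refl with ∈-resp-↭ W↭C'∷zs C∈W
  ...   | here C≡C'  = contradiction C≡C' C≢C'
  ...   | there C∈zs = subst (_∈ₗ map (_- x) zs) C-x≡C'-x (∈-map⁺ (_- x) C∈zs)

  ∣W′∣≤∣zs∣ : length W′ ≤ length zs
  ∣W′∣≤∣zs∣ = ≤-trans (Unique∧⊆⇒length≤ (deduplicate-! _≟ˢ_ (map (_- x) W)) W′⊆)
                     (≤-reflexive (length-map (_- x) zs))

  edges′ : ∀ {y} → y ∈ₗ D → Edge W′ y
  edges′ {y} y∈D with E , E' , E∈W , E'∈W , E≢E' , E-y≡E'-y ← edges (there y∈D) =
    E - x , E' - x , contract E∈W , contract E'∈W ,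
    (λ E-x≡E'-x → E≢E' (p-x≡q-x⇒p≡q (p-y≡q-y⇒x∈p⇒x∈q x≢y E-y≡E'-y)
                                   (p-y≡q-y⇒x∈p⇒x∈q x≢y (sym E-y≡E'-y)) E-x≡E'-x)) ,
    p-y≡q-y⇒p-x-y≡q-x-y E-y≡E'-y
    where
    x≢y : x ≢ y
    x≢y = All.lookup x≢D y∈D

module Ascent (top : Fin n → Subset n) (x∈top : ∀ x → x ∈ top x) where

  bot : Fin n → Subset n
  bot x = top x - x

  ∣top∣≡1+∣bot∣ : ∀ x → ∣ top x ∣ ≡ suc ∣ bot x ∣
  ∣top∣≡1+∣bot∣ x = x∈p⇒∣p∣≡1+∣p-x∣ (x∈top x)

  -- n edges on n + 1 vertices: were Q to split L, Bondy on either side would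
  -- leave room for at most n - 1 edges.
  module _ {ℓ} {Q : Pred (Subset n) ℓ} (Q? : Decidable Q) (Q-top⇔Q-bot : ∀ x → Q (top x) ⇔ Q (bot x))
           {L : List (Subset n)} (uL : Unique L) (∣L∣≡1+n : length L ≡ suc n)
           (top∈L : ∀ x → top x ∈ₗ L) (bot∈L : ∀ x → bot x ∈ₗ L) where

    edge-closed⇒universal : ∀ {A B} → A ∈ₗ L → Q A → B ∈ₗ L → Q B
    edge-closed⇒universal {A} {B} A∈L QA B∈L with Q? B
    ... | yes QB = QB
    ... | no ¬QB = contradiction split-bound (<-irrefl refl)
      where
      open Equivalence

      Q∘bot? : Decidable (λ x → Q (bot x))
      Q∘bot? x = Q? (bot x)

      Y Z : List (Fin n)
      Y = filter Q∘bot? (allFin n)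
      Z = filter (∁? Q∘bot?) (allFin n)

      LQ L¬Q : List (Subset n)
      LQ = filter Q? L
      L¬Q = filter (∁? Q?) L

      Q-side : length Y < length LQ
      Q-side = bondy Y (filter⁺ Q∘bot? (allFin⁺ n)) (filter⁺ Q? uL) (∈-filter⁺ Q? A∈L QA) edge
        where
        edge : ∀ {x} → x ∈ₗ Y → Edge LQ x
        edge {x} x∈Y with _ , Qbot ← ∈-filter⁻ Q∘bot? {xs = allFin n} x∈Y =
          removal-edge (x∈top x) (∈-filter⁺ Q? (top∈L x) (from (Q-top⇔Q-bot x) Qbot))
                                 (∈-filter⁺ Q? (bot∈L x) Qbot)

      ¬Q-side : length Z < length L¬Q
      ¬Q-side = bondy Z (filter⁺ (∁? Q∘bot?) (allFin⁺ n)) (filter⁺ (∁? Q?) uL) (∈-filter⁺ (∁? Q?) B∈L ¬QB) edge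
        where
        edge : ∀ {x} → x ∈ₗ Z → Edge L¬Q x
        edge {x} x∈Z with _ , ¬Qbot ← ∈-filter⁻ (∁? Q∘bot?) {xs = allFin n} x∈Z =
          removal-edge (x∈top x) (∈-filter⁺ (∁? Q?) (top∈L x) (¬Qbot ∘ to (Q-top⇔Q-bot x)))
                                 (∈-filter⁺ (∁? Q?) (bot∈L x) ¬Qbot)

      split-bound : suc (suc n) ≤ suc n
      split-bound = begin
        suc (suc n)                      ≡⟨ cong (λ (m : ℕ) → suc (suc m)) ∣Y∣+∣Z∣≡n ⟨
        suc (suc (length Y + length Z))  ≡⟨ cong suc (+-suc (length Y) (length Z)) ⟨
        suc (length Y) + suc (length Z)  ≤⟨ +-mono-≤ Q-side ¬Q-side ⟩
        length LQ + length L¬Q           ≡⟨ length-filter+length-filter-∁ Q? L ⟩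
        length L                         ≡⟨ ∣L∣≡1+n ⟩
        suc n                            ∎
        where
        open ≤-Reasoning
        ∣Y∣+∣Z∣≡n : length Y + length Z ≡ n
        ∣Y∣+∣Z∣≡n = trans (length-filter+length-filter-∁ Q∘bot? (allFin n)) (length-allFin n)

  Chain : ℕ → Subset n → Set
  Chain zero    A = A ≡ ⊥
  Chain (suc k) A = ∃[ x ] (top x ≡ A × Chain k (bot x))

  chain? : ∀ k → Decidable (Chain k)
  chain? zero    A = A ≟ˢ ⊥
  chain? (suc k) A = any? λ x → (top x ≟ˢ A) ×-dec chain? k (bot x)

  chain⇒∣A∣≡k : ∀ {k A} → Chain k A → ∣ A ∣ ≡ k
  chain⇒∣A∣≡k {zero}  refl              = ∣⊥∣≡0 n
  chain⇒∣A∣≡k {suc k} (x , refl , chain) = trans (∣top∣≡1+∣bot∣ x) (cong suc (chain⇒∣A∣≡k chain))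

  Reachable : Subset n → Set
  Reachable A = Chain ∣ A ∣ A

  reachable? : Decidable Reachable
  reachable? A = chain? ∣ A ∣ A

  chain⇒reachable : ∀ {k A} → Chain k A → Reachable A
  chain⇒reachable {A = A} chain = subst (λ k → Chain k A) (sym (chain⇒∣A∣≡k chain)) chain

  reachable-⊥ : Reachable ⊥
  reachable-⊥ = chain⇒reachable {zero} refl

  chain⇒reachable-bot : ∀ {k A} → Chain k A → y ∈ A → Reachable (bot y)
  chain⇒reachable-bot {k = zero}  refl y∈⊥ = contradiction y∈⊥ ∉⊥
  chain⇒reachable-bot {y = y} {suc k} (x , refl , chain) y∈top with y ≟ x
  ... | yes refl = chain⇒reachable chain
  ... | no y≢x   = chain⇒reachable-bot chain (x∈p∧x≢y⇒x∈p-y y∈top y≢x)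

  reachable-top⇔bot : ∀ x → Reachable (top x) ⇔ Reachable (bot x)
  reachable-top⇔bot x = mk⇔ (λ reach → chain⇒reachable-bot reach (x∈top x))
                            (λ reach → chain⇒reachable {suc _} (x , refl , reach))

  reachable⇒top : ∀ {A} → Reachable A → 1 ≤ ∣ A ∣ → ∃[ x ] top x ≡ A
  reachable⇒top {A} = go
    where
    go : ∀ {k} → Chain k A → 1 ≤ k → ∃[ x ] top x ≡ A
    go {suc k} (x , top≡A , _) _ = x , top≡A

module _ {n} (F : Fin n → Subset n) where

  MemberOrEmpty : Subset n → Set
  MemberOrEmpty A = A ≡ ⊥ ⊎ ∃[ k ] F k ≡ A

  Removable : Fin n → Set
  Removable x = ∃[ i ] (x ∈ F i × MemberOrEmpty (F i - x))

  ExtremalAt : Fin n → Set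
  ExtremalAt x = (∃[ i ] (F i - x ≡ ⊥)) ⊎ (∃[ i ] ∃[ j ] (i ≢ j × F i - x ≡ F j - x))

  members : List (Subset n)
  members = map F (allFin n)

  F∈members : ∀ i → F i ∈ₗ members
  F∈members i = ∈-map⁺ F (∈-allFin i)

  ∣members∣≡n : length members ≡ n
  ∣members∣≡n = trans (length-map F (allFin n)) (length-allFin n)

  memberOrEmpty∈ : ∀ {L A} → ⊥ ∈ₗ L → (∀ i → F i ∈ₗ L) → MemberOrEmpty A → A ∈ₗ L
  memberOrEmpty∈ ⊥∈L F∈L (inj₁ refl)       = ⊥∈L
  memberOrEmpty∈ ⊥∈L F∈L (inj₂ (k , refl)) = F∈L k

  removable⇒extremalAt : Removable x → ExtremalAt x
  removable⇒extremalAt (i , x∈Fi , inj₁ Fi-x≡⊥) = inj₁ (i , Fi-x≡⊥)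
  removable⇒extremalAt {x} (i , x∈Fi , inj₂ (k , Fk≡Fi-x)) =
    inj₂ (i , k , i≢k , trans (sym (p─q─q≡p─q (F i) ⁅ x ⁆)) (cong (_- x) (sym Fk≡Fi-x)))
    where
    i≢k : i ≢ k
    i≢k refl = x∉p-x x (F i) (subst (x ∈_) Fk≡Fi-x x∈Fi)

  extremalAt⇒removable : Distinct F → (∀ i → Nonempty (F i)) → ExtremalAt x → Removable x
  extremalAt⇒removable {x} _ nonempty (inj₁ (i , Fi-x≡⊥)) with y , y∈Fi ← nonempty i with y ≟ x
  ... | yes refl = i , y∈Fi , inj₁ Fi-x≡⊥
  ... | no y≢x   = contradiction (subst (y ∈_) Fi-x≡⊥ (x∈p∧x≢y⇒x∈p-y y∈Fi y≢x)) ∉⊥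
  extremalAt⇒removable {x} distinct _ (inj₂ (i , j , i≢j , Fi-x≡Fj-x)) with x ∈? F i | x ∈? F j
  ... | yes x∈Fi | yes x∈Fj = contradiction (distinct (p-x≡q-x⇒p≡q (λ _ → x∈Fj) (λ _ → x∈Fi) Fi-x≡Fj-x)) i≢j
  ... | yes x∈Fi | no x∉Fj  = i , x∈Fi , inj₂ (j , trans (sym (x∉p⇒p-x≡p x∉Fj)) (sym Fi-x≡Fj-x))
  ... | no x∉Fi  | yes x∈Fj = j , x∈Fj , inj₂ (i , trans (sym (x∉p⇒p-x≡p x∉Fi)) Fi-x≡Fj-x)
  ... | no x∉Fi  | no x∉Fj  =
    contradiction (distinct (p-x≡q-x⇒p≡q (λ x∈Fi → contradiction x∈Fi x∉Fi)
                                         (λ x∈Fj → contradiction x∈Fj x∉Fj) Fi-x≡Fj-x)) i≢j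

  removable⇒covers : (∀ x → Removable x) → CoversX F
  removable⇒covers removable x = proj₁ (removable x) , proj₁ (proj₂ (removable x))

  module Removals (removable : ∀ x → Removable x) where

    top : Fin n → Subset n
    top x = F (proj₁ (removable x))

    x∈top : ∀ x → x ∈ top x
    x∈top x = proj₁ (proj₂ (removable x))

    open Ascent top x∈top public

    bot∈ : ∀ {L} → ⊥ ∈ₗ L → (∀ i → F i ∈ₗ L) → ∀ x → bot x ∈ₗ L
    bot∈ ⊥∈L F∈L x = memberOrEmpty∈ ⊥∈L F∈L (proj₂ (proj₂ (removable x)))

  covers∧downClosed⇒removable : CoversX F → DownClosedStep F → ∀ x → Removable x
  covers∧downClosed⇒removable covers downClosed x =
    descend n (proj₁ (covers x)) (∣p∣≤n (F (proj₁ (covers x)))) (proj₂ (covers x))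
    where
    descend : ∀ s i → ∣ F i ∣ ≤ s → x ∈ F i → Removable x
    descend zero i ∣Fi∣≤0 x∈Fi = contradiction (subst (_≤ 0) (x∈p⇒∣p∣≡1+∣p-x∣ x∈Fi) ∣Fi∣≤0) λ ()
    descend (suc s) i ∣Fi∣≤1+s x∈Fi with 2 ≤? ∣ F i ∣
    ... | no ∣Fi∣≱2 = i , x∈Fi , inj₁ (x∈p⇒∣p∣≤1⇒p-x≡⊥ x∈Fi (≤-pred (≰⇒> ∣Fi∣≱2)))
    ... | yes ∣Fi∣≥2 with z , z∈Fi , j , Fj≡Fi-z ← downClosed i ∣Fi∣≥2 with x ≟ z
    ...   | yes refl = i , x∈Fi , inj₂ (j , Fj≡Fi-z)
    ...   | no x≢z   = descend s j ∣Fj∣≤s (subst (x ∈_) (sym Fj≡Fi-z) (x∈p∧x≢y⇒x∈p-y x∈Fi x≢z))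
      where
      ∣Fj∣≤s : ∣ F j ∣ ≤ s
      ∣Fj∣≤s = ≤-pred (subst (_≤ suc s) ∣Fi∣≡1+∣Fj∣ ∣Fi∣≤1+s)
        where
        ∣Fi∣≡1+∣Fj∣ : ∣ F i ∣ ≡ suc ∣ F j ∣
        ∣Fi∣≡1+∣Fj∣ = trans (x∈p⇒∣p∣≡1+∣p-x∣ z∈Fi) (cong (λ r → suc ∣ r ∣) (sym Fj≡Fi-z))

  removable⇒nonempty : Distinct F → (∀ x → Removable x) → ∀ i → Nonempty (F i)
  removable⇒nonempty distinct removable i with nonempty? (F i)
  ... | yes Fi≢⊥ = Fi≢⊥
  ... | no Fi-empty = contradiction n<n (<-irrefl refl)
    where
    open Removals removable
    ⊥∈members : ⊥ ∈ₗ members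
    ⊥∈members = subst (_∈ₗ members) (Empty-unique Fi-empty) (F∈members i)
    n<n : n < n
    n<n = subst₂ _<_ (length-allFin n) ∣members∣≡n
      (bondy (allFin n) (allFin⁺ n) (map⁺ distinct (allFin⁺ n)) (F∈members i)
         λ {x} _ → removal-edge (x∈top x) (F∈members _) (bot∈ ⊥∈members F∈members x))

  module _ (distinct : Distinct F) (nonempty : ∀ i → Nonempty (F i)) (removable : ∀ x → Removable x) where
    open Removals removable

    ⊥≢members : All.All (⊥ ≢_) members
    ⊥≢members = All.tabulate ⊥≢
      where
      ⊥≢ : ∀ {A} → A ∈ₗ members → ⊥ ≢ A
      ⊥≢ A∈members ⊥≡A with j , _ , refl ← ∈-map⁻ F A∈members with y , y∈Fj ← nonempty j =
        ∉⊥ (subst (y ∈_) (sym ⊥≡A) y∈Fj)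

    members-reachable : ∀ i → Reachable (F i)
    members-reachable i =
      edge-closed⇒universal reachable? reachable-top⇔bot (⊥≢members ∷ map⁺ distinct (allFin⁺ n))
        (cong suc ∣members∣≡n) (λ x → F∈L _) (bot∈ (here refl) F∈L) (here refl) reachable-⊥ (F∈L i)
      where
      F∈L : ∀ i → F i ∈ₗ ⊥ ∷ members
      F∈L i = there (F∈members i)

    removable⇒downClosed : DownClosedStep F
    removable⇒downClosed i ∣Fi∣≥2
      with x , top≡Fi ← reachable⇒top (members-reachable i) (≤-trans (s≤s z≤n) ∣Fi∣≥2)
      with proj₂ (proj₂ (removable x))
    ... | inj₂ (k , Fk≡bot) = x , subst (x ∈_) top≡Fi (x∈top x) , k , trans Fk≡bot (cong (_- x) top≡Fi)
    ... | inj₁ bot≡⊥ = contradiction (subst (2 ≤_) ∣Fi∣≡1 ∣Fi∣≥2) λ { (s≤s ()) }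
      where
      open ≡-Reasoning
      ∣Fi∣≡1 : ∣ F i ∣ ≡ 1
      ∣Fi∣≡1 = begin
        ∣ F i ∣          ≡⟨ cong ∣_∣ top≡Fi ⟨
        ∣ top x ∣        ≡⟨ ∣top∣≡1+∣bot∣ x ⟩
        suc ∣ bot x ∣    ≡⟨ cong (λ r → suc ∣ r ∣) bot≡⊥ ⟩
        suc ∣ ⊥ {n} ∣    ≡⟨ cong suc (∣⊥∣≡0 n) ⟩
        1                ∎

corollary2 : (n : ℕ) (F : Fin n → Subset n) → Distinct F →
    (Extremal F ⇔ (CoversX F × DownClosedStep F))
corollary2 n F distinct = mk⇔
  (λ (_ , nonempty , extremalAt) →
     let removable = λ x → extremalAt⇒removable F distinct nonempty (extremalAt x) in
     removable⇒covers F removable ,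
     removable⇒downClosed F distinct nonempty removable)
  (λ (covers , downClosed) →
     let removable = covers∧downClosed⇒removable F covers downClosed in
     distinct , removable⇒nonempty F distinct removable , λ x → removable⇒extremalAt F (removable x))
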